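{- Let $(R_c)_{c\ge1}$ be a row of the Trithoff array and let $D_c=R_{c+1}-R_c$ be its difference sequence. If $x$ is an entry of the row with canonical Tribonacci representation $a_k\cdots a_1a_0$, then the integer \[\sum_{i=0}^{k+1}(a_i+a_{i-1})\,T_{i+3}\qquad(a_{ -1}=a_{k+1}=0),\] i.e. the value of the word obtained by multiplying the digit string $a_k\cdots a_0$ by $11$ (in any integer base larger than $2$, so that no carries occur) and reading the result in the Tribonacci base, is a term of the sequence $(D_c)$.
   Context: Tribonacci numbers: $T_0=0,T_1=0,T_2=1$, $T_n=T_{n-1}+T_{n-2}+T_{n-3}$ ($n\ge3$). A canonical Tribonacci representation of $N\ge0$ is the unique word $a_k\cdots a_0$ with digits in $\{0,1\}$, no three consecutive $1$s, and $N=\sum_i a_iT_{i+3}$. Tribonacci successor: $\operatorname{out}(N)=\sum_i a_iT_{i+4}$. Trithoff array: entries $T_{r,c}$ ($r,c\ge1$), where $T_{r,1}$ is the $r$-th smallest positive integer whose canonical representation ends in $1$, and $T_{r,c+1}=\operatorname{out}(T_{r,c})$. -}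

module Defs where

open import Data.Nat using (ℕ; zero; suc; _+_; _*_; _∸_; _<_; _≤_)
open import Data.Bool using (Bool; true; false)
open import Data.List using (List; []; _∷_; _++_; map; zipWith; head; last; length)
open import Data.Maybe using (Maybe; just; nothing)
open import Data.Product using (Σ; _×_; ∃; ∃-syntax; _,_)
open import Data.Sum using (_⊎_)
open import Data.List.Membership.Propositional using (_∈_)
open import Data.List.Relation.Unary.AllPairs using (AllPairs)
open import Relation.Binary.PropositionalEquality using (_≡_)
open import Function.Bundles using (_⇔_)

T : ℕ → ℕ
T 0 = 0
T 1 = 0
T 2 = 1
T (suc (suc (suc n))) = T (suc (suc n)) + T (suc n) + T n

-- Words are LITTLE-ENDIAN lists of digits: the list  a₀ ∷ a₁ ∷ … ∷ aₖ ∷ []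
-- represents the written word aₖ⋯a₁a₀.

bit : Bool → ℕ
bit true  = 1
bit false = 0

valueFrom : ℕ → List ℕ → ℕ
valueFrom s []       = 0
valueFrom s (d ∷ ds) = d * T (s + 3) + valueFrom (suc s) ds

valueN : List ℕ → ℕ
valueN = valueFrom 0

val : List Bool → ℕ
val w = valueN (map bit w)

outVal : List Bool → ℕ
outVal w = valueFrom 1 (map bit w)

NoThreeOnes : List Bool → Set
NoThreeOnes (true ∷ true ∷ true ∷ _) = Data.Empty.⊥
  where import Data.Empty
NoThreeOnes [] = Data.Unit.⊤
  where import Data.Unit
NoThreeOnes (_ ∷ w) = NoThreeOnes w

Canonical : List Bool → Set
Canonical w = NoThreeOnes w × (w ≡ [] ⊎ last w ≡ just true)

IsCanRep : List Bool → ℕ → Set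
IsCanRep w N = Canonical w × val w ≡ N

Out : ℕ → ℕ → Set
Out N M = ∃[ w ] (IsCanRep w N × outVal w ≡ M)

EndsIn1 : ℕ → Set
EndsIn1 N = ∃[ w ] (IsCanRep w N × head w ≡ just true)

IsNthSmallestPos : (ℕ → Set) → ℕ → ℕ → Set
IsNthSmallestPos P r n =
  P n × 0 < n ×
  ∃[ l ] (AllPairs _<_ l × length l ≡ r ∸ 1 ×
          (∀ m → (m ∈ l) ⇔ (P m × 0 < m × m < n)))

-- R (indexed from 1; R 0 is irrelevant) is the r-th row of the Trithoff array
IsTrithoffRow : ℕ → (ℕ → ℕ) → Set
IsTrithoffRow r R =
  IsNthSmallestPos EndsIn1 r (R 1) × (∀ c → 1 ≤ c → Out (R c) (R (suc c)))

-- the digit word a·11 : digits b_i = a_i + a_{i-1}, i = 0 … k+1 (a_{-1} = a_{k+1} = 0)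
times11 : List Bool → List ℕ
times11 w = zipWith _+_ (map bit w ++ (0 ∷ [])) (0 ∷ map bit w)

-- Out acts on a canonical representation by appending a 0 (prepending, in the
-- little-endian lists used here), which keeps it canonical; as canonical representations are
-- unique, the row entries from x = R c on are Σ a_i T (i + k + 3), k = 0, 1, 2, ….  By the
-- Tribonacci recurrence, R (c + 3) − R (c + 2) = Σ a_i T (i + 4) + Σ a_i T (i + 3), which is the
-- value of the digit word w·11.  Uniqueness follows from T (n + 2) ≤ val w < T (n + 3) for a
-- canonical w of length n ≥ 1, by comparing top digits.
module Submission where

open import Defs
open import Data.Nat using (ℕ; zero; suc; _+_; _*_; _≤_; _<_; _≤′_; ≤′-reflexive; ≤′-step; z≤n; s≤s)
open import Data.Nat.Properties
open import Data.Nat.Tactic.RingSolver using (solve-∀)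
open import Data.Bool using (Bool; true; false)
open import Data.List using (List; []; _∷_; _++_; _∷ʳ_; map; length; last; zipWith)
open import Data.List.Properties using (length-++)
open import Data.List.Reverse using (Reverse; []; _∶_∶ʳ_; reverseView)
open import Data.Maybe using (just)
open import Data.Product using (∃-syntax; _×_; _,_; proj₁; proj₂)
open import Data.Sum using (inj₁; inj₂)
open import Data.Empty using (⊥; ⊥-elim)
open import Data.Unit using (tt)
open import Relation.Binary.PropositionalEquality
  using (_≡_; refl; sym; trans; cong; cong₂; subst; subst₂; module ≡-Reasoning)

T-suc-mono : ∀ n → T n ≤ T (suc n)
T-suc-mono 0 = z≤n
T-suc-mono 1 = z≤n
T-suc-mono 2 = s≤s z≤n
T-suc-mono (suc (suc (suc n))) = ≤-trans (m≤m+n _ (T (2 + n))) (m≤m+n _ (T (1 + n)))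

T-mono : ∀ {m n} → m ≤ n → T m ≤ T n
T-mono m≤n = go (≤⇒≤′ m≤n)
  where
    go : ∀ {m n} → m ≤′ n → T m ≤ T n
    go (≤′-reflexive refl) = ≤-refl
    go {n = suc n} (≤′-step m≤′n) = ≤-trans (go m≤′n) (T-suc-mono n)

T-reindex : ∀ n k s → T (n + (k + s)) ≡ T (k + n + s)
T-reindex n k s = cong T (+-exchange n k s)
  where
    +-exchange : ∀ n k s → n + (k + s) ≡ k + n + s
    +-exchange = solve-∀

valueFrom-recurrence : ∀ s ds → valueFrom (3 + s) ds ≡ valueFrom (2 + s) ds + valueFrom (1 + s) ds + valueFrom s ds
valueFrom-recurrence s [] = refl
valueFrom-recurrence s (d ∷ ds) =
  trans (cong (d * T (3 + s + 3) +_) (valueFrom-recurrence (suc s) ds)) (distrib d _ _ _ _ _ _)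
  where
    distrib : ∀ d a b c x y z → d * (a + b + c) + (x + y + z) ≡ d * a + x + (d * b + y) + (d * c + z)
    distrib = solve-∀

valueFrom-×11 : ∀ s ds p →
  valueFrom s (zipWith _+_ (ds ++ 0 ∷ []) (p ∷ ds)) ≡ p * T (s + 3) + (valueFrom s ds + valueFrom (suc s) ds)
valueFrom-×11 s [] p = refl
valueFrom-×11 s (d ∷ ds) p =
  trans (cong ((d + p) * T (s + 3) +_) (valueFrom-×11 (suc s) ds d)) (regroup d p _ _ _ _)
  where
    regroup : ∀ d p x y a b → (d + p) * x + (d * y + (a + b)) ≡ p * x + (d * x + a + (d * y + b))
    regroup = solve-∀

valueN-times11 : ∀ w → valueN (times11 w) ≡ val w + outVal w
valueN-times11 w = valueFrom-×11 0 (map bit w) 0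

shiftedVal : ℕ → List Bool → ℕ
shiftedVal s w = valueFrom s (map bit w)

shiftedVal-∷ʳ : ∀ s xs x → shiftedVal s (xs ∷ʳ x) ≡ shiftedVal s xs + bit x * T (length xs + s + 3)
shiftedVal-∷ʳ s [] x = +-identityʳ _
shiftedVal-∷ʳ s (y ∷ xs) x = begin
  bit y * T (s + 3) + shiftedVal (suc s) (xs ∷ʳ x)
    ≡⟨ cong (bit y * T (s + 3) +_) (shiftedVal-∷ʳ (suc s) xs x) ⟩
  bit y * T (s + 3) + (shiftedVal (suc s) xs + bit x * T (length xs + suc s + 3))
    ≡⟨ sym (+-assoc (bit y * T (s + 3)) _ _) ⟩
  bit y * T (s + 3) + shiftedVal (suc s) xs + bit x * T (length xs + suc s + 3)
    ≡⟨ cong (λ n → shiftedVal s (y ∷ xs) + bit x * T (n + 3)) (+-suc (length xs) s) ⟩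
  shiftedVal s (y ∷ xs) + bit x * T (suc (length xs) + s + 3) ∎
  where open ≡-Reasoning

val-∷ʳ : ∀ xs x → val (xs ∷ʳ x) ≡ val xs + bit x * T (3 + length xs)
val-∷ʳ xs x = trans (shiftedVal-∷ʳ 0 xs x) (cong (λ n → val xs + bit x * T n) index)
  where
    index : length xs + 0 + 3 ≡ 3 + length xs
    index = trans (cong (_+ 3) (+-identityʳ (length xs))) (+-comm (length xs) 3)

-- The summand T (2 + s) makes induction from the least significant digit go through;
-- for s = 0 it is val w < T (3 + length w).
shiftedVal-bound : ∀ s w → NoThreeOnes w → shiftedVal s w + T (2 + s) ≤ T (3 + length w + s)
shiftedVal-bound s [] _ = T-suc-mono (2 + s)
shiftedVal-bound s (false ∷ w) h = begin
  shiftedVal (1 + s) w + T (2 + s)  ≤⟨ +-monoʳ-≤ _ (T-suc-mono (2 + s)) ⟩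
  shiftedVal (1 + s) w + T (3 + s)  ≤⟨ shiftedVal-bound (1 + s) w h ⟩
  T (3 + length w + (1 + s))        ≡⟨ T-reindex (3 + length w) 1 s ⟩
  T (4 + length w + s)              ∎
  where open ≤-Reasoning
shiftedVal-bound s (true ∷ []) _ rewrite +-comm s 3 = begin
  1 * T (3 + s) + 0 + T (2 + s)  ≡⟨ normalise (T (3 + s)) (T (2 + s)) ⟩
  T (3 + s) + T (2 + s)          ≤⟨ m≤m+n _ (T (1 + s)) ⟩
  T (4 + s)                      ∎
  where
    open ≤-Reasoning
    normalise : ∀ x y → 1 * x + 0 + y ≡ x + y
    normalise = solve-∀
shiftedVal-bound s (true ∷ false ∷ w) h rewrite +-comm s 3 = begin
  1 * T (3 + s) + A + T (2 + s)  ≡⟨ normalise (T (3 + s)) A (T (2 + s)) ⟩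
  A + (T (3 + s) + T (2 + s))    ≤⟨ +-monoʳ-≤ A (m≤m+n _ (T (1 + s))) ⟩
  A + T (4 + s)                  ≤⟨ shiftedVal-bound (2 + s) w h ⟩
  T (3 + length w + (2 + s))     ≡⟨ T-reindex (3 + length w) 2 s ⟩
  T (5 + length w + s)           ∎
  where
    open ≤-Reasoning
    A = shiftedVal (2 + s) w
    normalise : ∀ x a y → 1 * x + a + y ≡ a + (x + y)
    normalise = solve-∀
shiftedVal-bound s (true ∷ true ∷ []) _ rewrite +-comm s 3 =
  ≤-reflexive (normalise (T (3 + s)) (T (4 + s)) (T (2 + s)))
  where
    normalise : ∀ x y z → 1 * x + (1 * y + 0) + z ≡ y + x + z
    normalise = solve-∀
shiftedVal-bound s (true ∷ true ∷ false ∷ w) h rewrite +-comm s 3 = begin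
  1 * T (3 + s) + (1 * T (4 + s) + A) + T (2 + s)  ≡⟨ normalise (T (3 + s)) (T (4 + s)) A (T (2 + s)) ⟩
  A + T (5 + s)                                    ≤⟨ shiftedVal-bound (3 + s) w h ⟩
  T (3 + length w + (3 + s))                       ≡⟨ T-reindex (3 + length w) 3 s ⟩
  T (6 + length w + s)                             ∎
  where
    open ≤-Reasoning
    A = shiftedVal (3 + s) w
    normalise : ∀ x y a z → 1 * x + (1 * y + a) + z ≡ a + (y + x + z)
    normalise = solve-∀
shiftedVal-bound s (true ∷ true ∷ true ∷ w) ()

T≤shiftedVal : ∀ s w → last w ≡ just true → T (2 + length w + s) ≤ shiftedVal s w
T≤shiftedVal s (true ∷ []) _ rewrite +-comm s 3 = ≤-reflexive (sym (normalise (T (3 + s))))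
  where
    normalise : ∀ x → 1 * x + 0 ≡ x
    normalise = solve-∀
T≤shiftedVal s (false ∷ []) ()
T≤shiftedVal s (a ∷ b ∷ w) l = begin
  T (2 + length (a ∷ b ∷ w) + s)      ≡⟨ sym (T-reindex (2 + length (b ∷ w)) 1 s) ⟩
  T (2 + length (b ∷ w) + (1 + s))    ≤⟨ T≤shiftedVal (1 + s) (b ∷ w) l ⟩
  shiftedVal (1 + s) (b ∷ w)          ≤⟨ m≤n+m _ (bit a * T (s + 3)) ⟩
  shiftedVal s (a ∷ b ∷ w)            ∎
  where open ≤-Reasoning

val<T : ∀ {w} → NoThreeOnes w → val w < T (3 + length w)
val<T {w} h = subst₂ _≤_ (+-comm (val w) 1) (cong T (+-identityʳ (3 + length w))) (shiftedVal-bound 0 w h)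

T≤val : ∀ {w} → last w ≡ just true → T (2 + length w) ≤ val w
T≤val {w} l = subst (_≤ val w) (cong T (+-identityʳ (2 + length w))) (T≤shiftedVal 0 w l)

noThreeOnes-++⁻ˡ : ∀ u {v} → NoThreeOnes (u ++ v) → NoThreeOnes u
noThreeOnes-++⁻ˡ [] _ = tt
noThreeOnes-++⁻ˡ (false ∷ u) h = noThreeOnes-++⁻ˡ u h
noThreeOnes-++⁻ˡ (true ∷ []) _ = tt
noThreeOnes-++⁻ˡ (true ∷ false ∷ u) h = noThreeOnes-++⁻ˡ (false ∷ u) h
noThreeOnes-++⁻ˡ (true ∷ true ∷ []) _ = tt
noThreeOnes-++⁻ˡ (true ∷ true ∷ false ∷ u) h = noThreeOnes-++⁻ˡ (true ∷ false ∷ u) h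
noThreeOnes-++⁻ˡ (true ∷ true ∷ true ∷ u) ()

length-∷ʳ : ∀ (xs : List Bool) x → length (xs ∷ʳ x) ≡ suc (length xs)
length-∷ʳ xs x = trans (length-++ xs) (+-comm (length xs) 1)

val-≤⇒length-≤ : ∀ {w w'} → NoThreeOnes w → last w' ≡ just true → val w' ≤ val w → length w' ≤ length w
val-≤⇒length-≤ {w} {w'} h l v'≤v = ≮⇒≥ λ |w|<|w'| → <⇒≱ (val<T {w} h) (begin
  T (3 + length w)  ≤⟨ T-mono (+-monoʳ-≤ 2 |w|<|w'|) ⟩
  T (2 + length w') ≤⟨ T≤val {w'} l ⟩
  val w'            ≤⟨ v'≤v ⟩
  val w             ∎)
  where open ≤-Reasoning

canonical-val-≤⇒length-≤ : ∀ {w w'} → Canonical w → NoThreeOnes w' → val w ≤ val w' → length w ≤ length w'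
canonical-val-≤⇒length-≤ (_ , inj₁ refl) _ _ = z≤n
canonical-val-≤⇒length-≤ {w} {w'} (_ , inj₂ l) h' v≤v' = val-≤⇒length-≤ {w'} {w} h' l v≤v'

digit-mismatch : ∀ {u v X} → v < X → u + 1 * X ≡ v + 0 → ⊥
digit-mismatch {u} {v} {X} v<X e = <⇒≱ v<X (begin
  X         ≤⟨ m≤n+m X u ⟩
  u + X     ≡⟨ cong (u +_) (sym (*-identityˡ X)) ⟩
  u + 1 * X ≡⟨ e ⟩
  v + 0     ≡⟨ +-identityʳ v ⟩
  v         ∎)
  where open ≤-Reasoning

top-digit-unique : ∀ {u v} X a b → u < X → v < X → u + bit a * X ≡ v + bit b * X → a ≡ b × u ≡ v
top-digit-unique X false false _ _ e = refl , +-cancelʳ-≡ 0 _ _ e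
top-digit-unique X true true _ _ e = refl , +-cancelʳ-≡ (1 * X) _ _ e
top-digit-unique {u} X true false _ v<X e = ⊥-elim (digit-mismatch {u} v<X e)
top-digit-unique {v = v} X false true u<X _ e = ⊥-elim (digit-mismatch {v} u<X (sym e))

equal-length-unique : ∀ {w w'} → Reverse w → Reverse w' → length w ≡ length w' →
  NoThreeOnes w → NoThreeOnes w' → val w ≡ val w' → w ≡ w'
equal-length-unique [] [] _ _ _ _ = refl
equal-length-unique [] (ys ∶ _ ∶ʳ y) e _ _ _ = ⊥-elim (0≢1+n (trans e (length-∷ʳ ys y)))
equal-length-unique (xs ∶ _ ∶ʳ x) [] e _ _ _ = ⊥-elim (0≢1+n (trans (sym e) (length-∷ʳ xs x)))
equal-length-unique (xs ∶ r ∶ʳ x) (ys ∶ r' ∶ʳ y) e h h' v =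
  cong₂ _∷ʳ_ (equal-length-unique r r' |xs|≡|ys| hx hy (proj₂ top-digits)) (proj₁ top-digits)
  where
    |xs|≡|ys| : length xs ≡ length ys
    |xs|≡|ys| = suc-injective (trans (sym (length-∷ʳ xs x)) (trans e (length-∷ʳ ys y)))
    hx : NoThreeOnes xs
    hx = noThreeOnes-++⁻ˡ xs h
    hy : NoThreeOnes ys
    hy = noThreeOnes-++⁻ˡ ys h'
    ys<T : val ys < T (3 + length xs)
    ys<T = subst (λ n → val ys < T (3 + n)) (sym |xs|≡|ys|) (val<T {ys} hy)
    top-eq : val xs + bit x * T (3 + length xs) ≡ val ys + bit y * T (3 + length xs)
    top-eq = begin
      val xs + bit x * T (3 + length xs) ≡⟨ sym (val-∷ʳ xs x) ⟩
      val (xs ∷ʳ x)                      ≡⟨ v ⟩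
      val (ys ∷ʳ y)                      ≡⟨ val-∷ʳ ys y ⟩
      val ys + bit y * T (3 + length ys) ≡⟨ cong (λ n → val ys + bit y * T (3 + n)) (sym |xs|≡|ys|) ⟩
      val ys + bit y * T (3 + length xs) ∎
      where open ≡-Reasoning
    top-digits : x ≡ y × val xs ≡ val ys
    top-digits = top-digit-unique (T (3 + length xs)) x y (val<T {xs} hx) ys<T top-eq

canonical-unique : ∀ {w w'} → Canonical w → Canonical w' → val w ≡ val w' → w ≡ w'
canonical-unique {w} {w'} c c' v =
  equal-length-unique (reverseView w) (reverseView w') same-length (proj₁ c) (proj₁ c') v
  where
    same-length : length w ≡ length w'
    same-length = ≤-antisym (canonical-val-≤⇒length-≤ {w} {w'} c (proj₁ c') (≤-reflexive v))
                            (canonical-val-≤⇒length-≤ {w'} {w} c' (proj₁ c) (≤-reflexive (sym v)))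

out-unique : ∀ {w N M} → IsCanRep w N → Out N M → M ≡ outVal w
out-unique (c , v) (w' , (c' , v') , o) = trans (sym o) (cong outVal (canonical-unique c' c (trans v' (sym v))))

-- The empty word, representing 0, is kept: false ∷ [] is not canonical, and out 0 = 0.
shift : List Bool → List Bool
shift [] = []
shift (a ∷ w) = false ∷ a ∷ w

canonical-shift : ∀ {w} → Canonical w → Canonical (shift w)
canonical-shift {[]} c = c
canonical-shift {_ ∷ _} (h , inj₂ l) = h , inj₂ l

shiftedVal-shift : ∀ s w → shiftedVal s (shift w) ≡ shiftedVal (suc s) w
shiftedVal-shift s [] = refl
shiftedVal-shift s (_ ∷ _) = refl

row-entry≡shiftedVal : ∀ {R : ℕ → ℕ} → (∀ c → 1 ≤ c → Out (R c) (R (suc c))) →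
  ∀ k {c} w → 1 ≤ c → IsCanRep w (R c) → R (k + c) ≡ shiftedVal k w
row-entry≡shiftedVal step zero w _ (_ , v) = sym v
row-entry≡shiftedVal {R} step (suc k) {c} w c≥1 rep = begin
  R (suc k + c)           ≡⟨ cong R (sym (+-suc k c)) ⟩
  R (k + suc c)           ≡⟨ row-entry≡shiftedVal step k (shift w) (s≤s z≤n) shifted-rep ⟩
  shiftedVal k (shift w)  ≡⟨ shiftedVal-shift k w ⟩
  shiftedVal (suc k) w    ∎
  where
    open ≡-Reasoning
    shifted-rep : IsCanRep (shift w) (R (suc c))
    shifted-rep = canonical-shift (proj₁ rep) , trans (shiftedVal-shift 0 w) (sym (out-unique rep (step c c≥1)))

mainTheorem7 : (r : ℕ) → 1 ≤ r → (R : ℕ → ℕ) → IsTrithoffRow r R →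
    (c : ℕ) → 1 ≤ c → (w : List Bool) → IsCanRep w (R c) →
    ∃[ d ] (1 ≤ d × R (d + 1) ≡ R d + valueN (times11 w))
mainTheorem7 _ _ R (_ , step) c c≥1 w rep = 2 + c , s≤s z≤n , (begin
  R (2 + c + 1)                                        ≡⟨ cong R (+-comm (2 + c) 1) ⟩
  R (3 + c)                                            ≡⟨ entry 3 ⟩
  valueFrom 3 ds                                       ≡⟨ valueFrom-recurrence 0 ds ⟩
  valueFrom 2 ds + valueFrom 1 ds + valueFrom 0 ds     ≡⟨ +-assoc (valueFrom 2 ds) _ _ ⟩
  valueFrom 2 ds + (valueFrom 1 ds + valueFrom 0 ds)   ≡⟨ cong (valueFrom 2 ds +_) (+-comm (valueFrom 1 ds) _) ⟩
  valueFrom 2 ds + (valueFrom 0 ds + valueFrom 1 ds)   ≡⟨ cong₂ _+_ (sym (entry 2)) (sym (valueN-times11 w)) ⟩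
  R (2 + c) + valueN (times11 w)                       ∎)
  where
    open ≡-Reasoning
    ds : List ℕ
    ds = map bit w
    entry : ∀ k → R (k + c) ≡ shiftedVal k w
    entry k = row-entry≡shiftedVal step k w c≥1 rep
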